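{- Let $a$ be a positive integer. Let $\mathbf{S}\in\mathbb{Q}[[t_1,\dots,t_{2a}]]$ be the unique formal power series with constant term $1$ satisfying $$0=1-\mathbf{S}+\sum_{k=1}^{2a} t_k\,\mathbf{S}^{k+1},$$ and let $\mathbf{G}[t_1,\dots,t_{2a}]\in\mathbb{Q}[[t_1,\dots,t_{2a}]]$ be the formal power series with $\mathbf{S}-1=(t_1+t_2+\cdots+t_{2a})\,\mathbf{G}$. Then substituting $t_{2j-1}=-f$ and $t_{2j}=f$ for $j=1,\dots,a$ gives $$\mathbf{G}[-f,f,-f,f,\dots,-f,f]=\sum_{n\ge0}a^n f^n$$ as formal power series in $f$.
   Context: Here $\mathbf{S}$ is the series solution $\alpha$ of $0=1-\alpha+\sum_{k=1}^{2a}t_k\alpha^{k+1}$ (the variable $t_k$ multiplies $\alpha^{k+1}$). It is known that $\mathbf{S}-1$ is divisible by $t_1+\cdots+t_{2a}$ in the ring of formal power series, so $\mathbf{G}$ (the "Geode series", equivalently the general Geode series in $t_1,t_2,\dots$ with $t_k=0$ for $k>2a$) is a well-defined formal power series; the substitution is performed in $\mathbf{G}$ itself (even though $t_1+\cdots+t_{2a}$ becomes $0$ under it). -}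

module Defs where

open import Data.Nat as ℕ using (ℕ; zero; suc)
open import Data.Fin as Fin using (Fin; toℕ)
open import Data.Vec using (Vec; []; _∷_; zipWith; tabulate)
open import Data.Vec.Properties using (≡-dec)
open import Data.List using (List; []; _∷_; [_]; map; concatMap; upTo; foldr; allFin)
open import Data.Rational using (ℚ; 0ℚ; 1ℚ; _+_; _*_; -_; _-_; _/_)
open import Data.Integer using (+_)
open import Relation.Nullary using (does)
open import Data.Bool using (Bool; true; false; if_then_else_)

-- Formal power series in k variables over ℚ, as coefficient functions on
-- exponent vectors (m₀,…,m_{k-1}); position i corresponds to variable t_{i+1}.
Series : ℕ → Set
Series k = Vec ℕ k → ℚ

sumℚ : List ℚ → ℚ
sumℚ = foldr _+_ 0ℚ

below : ∀ {k} → Vec ℕ k → List (Vec ℕ k)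
below [] = [ [] ]
below (x ∷ xs) = concatMap (λ i → map (i ∷_) (below xs)) (upTo (suc x))

_⊛_ : ∀ {k} → Series k → Series k → Series k
(f ⊛ g) m = sumℚ (map (λ d → f d * g (zipWith ℕ._∸_ m d)) (below m))

isV : ∀ {k} → Vec ℕ k → Vec ℕ k → Bool
isV u m = does (≡-dec ℕ._≟_ m u)

zeroV : ∀ k → Vec ℕ k
zeroV k = tabulate (λ _ → 0)

unitV : ∀ {k} → Fin k → Vec ℕ k
unitV i = tabulate (λ j → if does (i Fin.≟ j) then 1 else 0)

oneS : ∀ {k} → Series k
oneS {k} m = if isV (zeroV k) m then 1ℚ else 0ℚ

var : ∀ {k} → Fin k → Series k
var i m = if isV (unitV i) m then 1ℚ else 0ℚ

pow : ∀ {k} → Series k → ℕ → Series k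
pow f zero = oneS
pow f (suc n) = f ⊛ pow f n

-- Σ_{k=1}^{K} t_k S^{k+1}  (index i = k-1, power i+2)
sumTerm : ∀ {K} → Series K → Series K
sumTerm {K} S m = sumℚ (map (λ i → (var i ⊛ pow S (suc (suc (toℕ i)))) m) (allFin K))

linSum : ∀ {K} → Series K
linSum {K} m = sumℚ (map (λ i → var i m) (allFin K))

comps : (k n : ℕ) → List (Vec ℕ k)
comps zero zero = [ [] ]
comps zero (suc n) = []
comps (suc k) n = concatMap (λ i → map (i ∷_) (comps k (n ℕ.∸ i))) (upTo (suc n))

negPow : ℕ → ℚ
negPow zero = 1ℚ
negPow (suc n) = - negPow n

-- sign of the monomial t^m under t_{odd} = -f, t_{even} = f
-- (flag true = current position is t_{2j-1})
altSign : ∀ {k} → Bool → Vec ℕ k → ℚ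
altSign b [] = 1ℚ
altSign true (x ∷ xs) = negPow x * altSign false xs
altSign false (x ∷ xs) = altSign true xs

-- coefficient of f^n in G[-f,f,-f,f,…]
substCoeff : ∀ {k} → Series k → ℕ → ℚ
substCoeff {k} G n = sumℚ (map (λ m → altSign true m * G m) (comps k n))

natℚ : ℕ → ℚ
natℚ n = + n / 1

{-# OPTIONS --safe #-}
module Submission where

-- Substituting t_i = c_i f is a ring homomorphism from power series in t_1, …, t_K to power
-- series in f, but for c = (-1, 1, …, -1, 1) it kills t_1 + ⋯ + t_K, so S - 1 = (Σ t_i) G says
-- nothing about the image of G. We therefore substitute over the dual numbers ℚ[ε]/(ε²) and
-- perturb c_1 to -1 + ε, so that Σ c_i = ε while the real parts of the c_i are unchanged.
-- For the images P of S and Q of G this gives P = 1 + ε f Q, hence P^j = 1 + j ε f Q, and the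
-- functional equation P = 1 + f Σ_i c_i P^(i+2) becomes ε f Q = ε f + (Σ_i c_i (i + 2)) ε f² Q,
-- where Σ_i c_i (i + 2) ε = (−2 + 3 − 4 + 5 − ⋯) ε = a ε. Hence re Q = 1 + a f re Q, and re Q is
-- G[-f, f, …, -f, f].

open import Level using (0ℓ)
open import Algebra.Bundles using (CommutativeRing)
open import Algebra.Core using (Op₁; Op₂)
open import Algebra.Structures using (IsCommutativeRing)
import Algebra.Properties.CommutativeSemigroup as CommutativeSemigroupProperties
import Algebra.Properties.Ring as RingProperties
import Algebra.Properties.Semiring.Exp as SemiringExp
import Algebra.Properties.Semiring.Mult as SemiringMult
open import Data.Bool using (Bool; true; false)
open import Data.Fin as Fin using (Fin; toℕ)
import Data.Integer as ℤ
import Data.Integer.Properties as ℤP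
open import Data.List using (List; []; _∷_; _++_; map; concatMap; applyUpTo; upTo; allFin; foldr)
open import Data.List.Properties using (map-cong; map-∘; map-++; map-upTo; map-tabulate)
open import Data.Nat as ℕ using (ℕ; zero; suc; _∸_; _<_; _≤_; s≤s; z≤n)
import Data.Nat.Coprimality as Coprime
import Data.Nat.Properties as ℕP
open import Data.Product using (_,_)
import Data.Rational as ℚ
import Data.Rational.Properties as ℚP
open import Data.Vec as Vec using (Vec; []; _∷_; lookup)
open import Function using (_∘_; id)
open import Relation.Binary.PropositionalEquality
open import Relation.Nullary.Decidable.Core using (dec⇒maybe)
open import Tactic.RingSolver using (solve-∀)
open import Tactic.RingSolver.Core.AlmostCommutativeRing using (AlmostCommutativeRing; fromCommutativeRing)

open import Defs

module Substitution
  {A : Set} {add mul : Op₂ A} {neg : Op₁ A} {zeroᴬ oneᴬ : A}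
  (isCommutativeRing : IsCommutativeRing _≡_ add mul neg zeroᴬ oneᴬ)
  (ι : ℚ.ℚ → A)
  (ι-0 : ι ℚ.0ℚ ≡ zeroᴬ) (ι-1 : ι ℚ.1ℚ ≡ oneᴬ)
  (ι-+ : ∀ p q → ι (p ℚ.+ q) ≡ add (ι p) (ι q))
  (ι-* : ∀ p q → ι (p ℚ.* q) ≡ mul (ι p) (ι q))
  where

  commutativeRing : CommutativeRing 0ℓ 0ℓ
  commutativeRing = record { isCommutativeRing = isCommutativeRing }

  open CommutativeRing commutativeRing
    using (_+_; _*_; -_; 0#; 1#; semiring; ring; +-commutativeSemigroup; *-commutativeSemigroup;
           +-assoc; +-comm; +-identityˡ; +-identityʳ; -‿inverseˡ;
           *-assoc; *-comm; *-identityˡ; *-identityʳ; distribˡ; distribʳ; zeroˡ; zeroʳ)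
  open RingProperties ring using (-1*x≈-x)
  open SemiringExp semiring public using (_^_)
  open SemiringExp semiring using (^-homo-*)
  open SemiringMult semiring public using (_×_)
  open SemiringMult semiring using (×-comm-*)
  open CommutativeSemigroupProperties +-commutativeSemigroup
    using (xy∙z≈xz∙y; xy∙z≈y∙xz) renaming (interchange to +-interchange)
  open CommutativeSemigroupProperties *-commutativeSemigroup
    using () renaming (interchange to *-interchange)

  private variable
    B C : Set

  sum : List A → A
  sum = foldr _+_ 0#

  sum-++ : ∀ xs ys → sum (xs ++ ys) ≡ sum xs + sum ys
  sum-++ []       ys = sym (+-identityˡ _)
  sum-++ (x ∷ xs) ys = trans (cong (x +_) (sum-++ xs ys)) (sym (+-assoc x _ _))

  sum-map-cong : ∀ {f g : B → A} → (∀ x → f x ≡ g x) → ∀ xs → sum (map f xs) ≡ sum (map g xs)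
  sum-map-cong f≗g xs = cong sum (map-cong f≗g xs)

  sum-map-0# : ∀ (xs : List B) → sum (map (λ _ → 0#) xs) ≡ 0#
  sum-map-0# []       = refl
  sum-map-0# (x ∷ xs) = trans (cong (0# +_) (sum-map-0# xs)) (+-identityˡ 0#)

  sum-map-+ : ∀ (f g : B → A) xs → sum (map (λ x → f x + g x) xs) ≡ sum (map f xs) + sum (map g xs)
  sum-map-+ f g []       = sym (+-identityˡ 0#)
  sum-map-+ f g (x ∷ xs) = trans (cong (f x + g x +_) (sum-map-+ f g xs)) (+-interchange _ _ _ _)

  sum-map-*ˡ : ∀ c (f : B → A) xs → c * sum (map f xs) ≡ sum (map (λ x → c * f x) xs)
  sum-map-*ˡ c f []       = zeroʳ c
  sum-map-*ˡ c f (x ∷ xs) = trans (distribˡ c _ _) (cong (c * f x +_) (sum-map-*ˡ c f xs))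

  sum-map-swap : ∀ (F : B → C → A) xs ys →
    sum (map (λ x → sum (map (F x) ys)) xs) ≡ sum (map (λ y → sum (map (λ x → F x y) xs)) ys)
  sum-map-swap F []       ys = sym (sum-map-0# ys)
  sum-map-swap F (x ∷ xs) ys = trans (cong (sum (map (F x) ys) +_) (sum-map-swap F xs ys))
                                     (sym (sum-map-+ (F x) _ ys))

  sum-concatMap : ∀ (h : C → A) (f : B → List C) xs →
    sum (map h (concatMap f xs)) ≡ sum (map (λ x → sum (map h (f x))) xs)
  sum-concatMap h f []       = refl
  sum-concatMap h f (x ∷ xs) = begin
    sum (map h (f x ++ concatMap f xs))              ≡⟨ cong sum (map-++ h (f x) _) ⟩
    sum (map h (f x) ++ map h (concatMap f xs))      ≡⟨ sum-++ (map h (f x)) _ ⟩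
    sum (map h (f x)) + sum (map h (concatMap f xs)) ≡⟨ cong (_ +_) (sum-concatMap h f xs) ⟩
    sum (map h (f x)) + sum (map (λ x → sum (map h (f x))) xs) ∎
    where open ≡-Reasoning

  Σ< : ℕ → (ℕ → A) → A
  Σ< n F = sum (applyUpTo F n)

  Σ≤ : ℕ → (ℕ → A) → A
  Σ≤ n = Σ< (suc n)

  sum-map-upTo : ∀ F n → sum (map F (upTo n)) ≡ Σ< n F
  sum-map-upTo F n = cong sum (map-upTo F n)

  Σ<-cong : ∀ n {F G : ℕ → A} → (∀ i → i < n → F i ≡ G i) → Σ< n F ≡ Σ< n G
  Σ<-cong zero    eq = refl
  Σ<-cong (suc n) eq = cong₂ _+_ (eq 0 (s≤s z≤n)) (Σ<-cong n (λ i i<n → eq (suc i) (s≤s i<n)))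

  Σ<-zero : ∀ n {F : ℕ → A} → (∀ i → i < n → F i ≡ 0#) → Σ< n F ≡ 0#
  Σ<-zero zero    eq = refl
  Σ<-zero (suc n) eq =
    trans (cong₂ _+_ (eq 0 (s≤s z≤n)) (Σ<-zero n (λ i i<n → eq (suc i) (s≤s i<n)))) (+-identityˡ 0#)

  Σ<-+ : ∀ n (F G : ℕ → A) → Σ< n (λ i → F i + G i) ≡ Σ< n F + Σ< n G
  Σ<-+ zero    F G = sym (+-identityˡ 0#)
  Σ<-+ (suc n) F G = trans (cong (F 0 + G 0 +_) (Σ<-+ n (F ∘ suc) (G ∘ suc))) (+-interchange _ _ _ _)

  Σ<-*ˡ : ∀ n c (F : ℕ → A) → c * Σ< n F ≡ Σ< n (λ i → c * F i)
  Σ<-*ˡ zero    c F = zeroʳ c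
  Σ<-*ˡ (suc n) c F = trans (distribˡ c _ _) (cong (c * F 0 +_) (Σ<-*ˡ n c (F ∘ suc)))

  Σ<-*ʳ : ∀ n c (F : ℕ → A) → Σ< n F * c ≡ Σ< n (λ i → F i * c)
  Σ<-*ʳ n c F = trans (*-comm _ c) (trans (Σ<-*ˡ n c F) (Σ<-cong n (λ i _ → *-comm c (F i))))

  Σ<-last : ∀ n (F : ℕ → A) → Σ< (suc n) F ≡ Σ< n F + F n
  Σ<-last zero    F = trans (+-identityʳ _) (sym (+-identityˡ _))
  Σ<-last (suc n) F = trans (cong (F 0 +_) (Σ<-last n (F ∘ suc))) (sym (+-assoc _ _ _))

  Σ≤-reassoc : ∀ N (G : ℕ → ℕ → ℕ → A) →
    Σ≤ N (λ p → Σ≤ p (λ i → G i (p ∸ i) (N ∸ p))) ≡ Σ≤ N (λ i → Σ≤ (N ∸ i) (λ j → G i j (N ∸ i ∸ j)))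
  Σ≤-reassoc zero    G = refl
  Σ≤-reassoc (suc N) G = begin
    (G 0 0 (suc N) + 0#) + Σ≤ N (λ p → first p + rest p)
      ≡⟨ cong₂ _+_ (+-identityʳ _) (Σ<-+ (suc N) first rest) ⟩
    G 0 0 (suc N) + (Σ≤ N first + Σ≤ N rest)
      ≡⟨ cong (λ t → G 0 0 (suc N) + (Σ≤ N first + t)) (Σ≤-reassoc N (G ∘ suc)) ⟩
    G 0 0 (suc N) + (Σ≤ N first + Σ≤ N (λ i → Σ≤ (N ∸ i) (λ j → G (suc i) j (N ∸ i ∸ j))))
      ≡⟨ sym (+-assoc _ _ _) ⟩
    (G 0 0 (suc N) + Σ≤ N first) + Σ≤ N (λ i → Σ≤ (N ∸ i) (λ j → G (suc i) j (N ∸ i ∸ j))) ∎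
    where
    open ≡-Reasoning
    first rest : ℕ → A
    first p = G 0 (suc p) (N ∸ p)
    rest  p = Σ≤ p (λ i → G (suc i) (p ∸ i) (N ∸ p))

  Σ≤-triangle-peel : ∀ N (H : ℕ → ℕ → A) →
    Σ≤ (suc N) (λ x → Σ≤ (suc N ∸ x) (H x)) ≡ Σ≤ (suc N) (λ x → H x 0) + Σ≤ N (λ x → Σ≤ (N ∸ x) (H x ∘ suc))
  Σ≤-triangle-peel N H = begin
    Σ≤ (suc N) (λ x → Σ≤ (suc N ∸ x) (H x))
      ≡⟨ Σ<-last (suc N) (λ x → Σ≤ (suc N ∸ x) (H x)) ⟩
    Σ≤ N (λ x → Σ≤ (suc N ∸ x) (H x)) + Σ≤ (suc N ∸ suc N) (H (suc N))
      ≡⟨ cong₂ _+_ (Σ<-cong (suc N) (λ x x<1+N → cong (λ t → Σ≤ t (H x)) (ℕP.+-∸-assoc 1 (ℕP.≤-pred x<1+N))))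
                   (cong (λ t → Σ≤ t (H (suc N))) (ℕP.n∸n≡0 N)) ⟩
    Σ≤ N (λ x → H x 0 + rest x) + (H (suc N) 0 + 0#)
      ≡⟨ cong₂ _+_ (Σ<-+ (suc N) (λ x → H x 0) rest) (+-identityʳ _) ⟩
    (Σ≤ N (λ x → H x 0) + Σ≤ N rest) + H (suc N) 0
      ≡⟨ xy∙z≈xz∙y _ _ _ ⟩
    (Σ≤ N (λ x → H x 0) + H (suc N) 0) + Σ≤ N rest
      ≡⟨ cong (_+ Σ≤ N rest) (sym (Σ<-last (suc N) (λ x → H x 0))) ⟩
    Σ≤ (suc N) (λ x → H x 0) + Σ≤ N rest ∎
    where
    open ≡-Reasoning
    rest : ℕ → A
    rest x = Σ≤ (N ∸ x) (H x ∘ suc)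

  Σ≤-triangle-swap : ∀ N (H : ℕ → ℕ → A) →
    Σ≤ N (λ x → Σ≤ (N ∸ x) (H x)) ≡ Σ≤ N (λ y → Σ≤ (N ∸ y) (λ x → H x y))
  Σ≤-triangle-swap zero    H = refl
  Σ≤-triangle-swap (suc N) H = trans (Σ≤-triangle-peel N H)
    (cong (Σ≤ (suc N) (λ x → H x 0) +_) (Σ≤-triangle-swap N (λ x y → H x (suc y))))

  infixl 7 _⋆_

  _⋆_ : (ℕ → A) → (ℕ → A) → ℕ → A
  (F ⋆ G) n = Σ≤ n (λ j → F j * G (n ∸ j))

  ⋆-cong : ∀ {F F′ G G′ : ℕ → A} → (∀ j → F j ≡ F′ j) → (∀ j → G j ≡ G′ j) →
           ∀ n → (F ⋆ G) n ≡ (F′ ⋆ G′) n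
  ⋆-cong F≗F′ G≗G′ n = Σ<-cong (suc n) (λ j _ → cong₂ _*_ (F≗F′ j) (G≗G′ (n ∸ j)))

  _⋆₂_ : (ℕ → ℕ → A) → (ℕ → ℕ → A) → ℕ → ℕ → A
  (a ⋆₂ b) x = λ j → Σ≤ x (λ i → (a i ⋆ b (x ∸ i)) j)

  -- The coefficient of fⁿ in Σₓ (c₀ f)ˣ Aₓ, where a x is the coefficient sequence of Aₓ.
  diagonal : A → (ℕ → ℕ → A) → ℕ → A
  diagonal c₀ a n = Σ≤ n (λ x → c₀ ^ x * a x (n ∸ x))

  diagonal-cong : ∀ c₀ {a a′ : ℕ → ℕ → A} → (∀ x j → a x j ≡ a′ x j) →
                  ∀ n → diagonal c₀ a n ≡ diagonal c₀ a′ n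
  diagonal-cong c₀ a≗a′ n = Σ<-cong (suc n) (λ x _ → cong (c₀ ^ x *_) (a≗a′ x (n ∸ x)))

  module _ (c₀ : A) (a b : ℕ → ℕ → A) where

    private
      T : ℕ → ℕ → ℕ → ℕ → A
      T i l j r = (c₀ ^ i * c₀ ^ l) * (a i j * b l r)

    diagonal₂ : ℕ → A
    diagonal₂ n = Σ≤ n (λ i → Σ≤ (n ∸ i) (λ j → Σ≤ (n ∸ i ∸ j) (λ l → T i l j (n ∸ i ∸ j ∸ l))))

    diagonal-⋆₂≡diagonal₂ : ∀ n → diagonal c₀ (a ⋆₂ b) n ≡ diagonal₂ n
    diagonal-⋆₂≡diagonal₂ n = begin
      Σ≤ n (λ x → c₀ ^ x * Σ≤ x (λ i → (a i ⋆ b (x ∸ i)) (n ∸ x)))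
        ≡⟨ Σ<-cong (suc n) (λ x _ → split-power x (n ∸ x)) ⟩
      Σ≤ n (λ x → Σ≤ x (λ i → Σ≤ (n ∸ x) (λ j → T i (x ∸ i) j (n ∸ x ∸ j))))
        ≡⟨ Σ≤-reassoc n (λ i l r → Σ≤ r (λ j → T i l j (r ∸ j))) ⟩
      Σ≤ n (λ i → Σ≤ (n ∸ i) (λ l → Σ≤ (n ∸ i ∸ l) (λ j → T i l j (n ∸ i ∸ l ∸ j))))
        ≡⟨ Σ<-cong (suc n) (λ i _ → Σ≤-triangle-swap (n ∸ i) (λ l j → T i l j (n ∸ i ∸ l ∸ j))) ⟩
      Σ≤ n (λ i → Σ≤ (n ∸ i) (λ j → Σ≤ (n ∸ i ∸ j) (λ l → T i l j (n ∸ i ∸ l ∸ j))))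
        ≡⟨ Σ<-cong (suc n) (λ i _ → Σ<-cong (suc (n ∸ i)) (λ j _ → Σ<-cong (suc (n ∸ i ∸ j)) (λ l _ →
             cong (T i l j) (∸-comm (n ∸ i) l j)))) ⟩
      diagonal₂ n ∎
      where
      open ≡-Reasoning
      ∸-comm : ∀ m p q → m ∸ p ∸ q ≡ m ∸ q ∸ p
      ∸-comm m p q = trans (ℕP.∸-+-assoc m p q)
        (trans (cong (m ∸_) (ℕP.+-comm p q)) (sym (ℕP.∸-+-assoc m q p)))
      ^-split : ∀ {i x} → i ≤ x → c₀ ^ x ≡ c₀ ^ i * c₀ ^ (x ∸ i)
      ^-split {i} {x} i≤x = trans (cong (c₀ ^_) (sym (ℕP.m+[n∸m]≡n i≤x))) (^-homo-* c₀ i (x ∸ i))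
      split-power : ∀ x r → c₀ ^ x * Σ≤ x (λ i → (a i ⋆ b (x ∸ i)) r)
                          ≡ Σ≤ x (λ i → Σ≤ r (λ j → T i (x ∸ i) j (r ∸ j)))
      split-power x r = trans (Σ<-*ˡ (suc x) (c₀ ^ x) (λ i → (a i ⋆ b (x ∸ i)) r))
        (Σ<-cong (suc x) (λ i i<1+x → trans (Σ<-*ˡ (suc r) (c₀ ^ x) (λ j → a i j * b (x ∸ i) (r ∸ j)))
          (Σ<-cong (suc r) (λ j _ → cong (_* (a i j * b (x ∸ i) (r ∸ j))) (^-split (ℕP.≤-pred i<1+x))))))

    ⋆-diagonal≡diagonal₂ : ∀ n → (diagonal c₀ a ⋆ diagonal c₀ b) n ≡ diagonal₂ n
    ⋆-diagonal≡diagonal₂ n = begin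
      Σ≤ n (λ p → diagonal c₀ a p * diagonal c₀ b (n ∸ p))
        ≡⟨ Σ<-cong (suc n) (λ p _ → Σ<-*ʳ (suc p) (diagonal c₀ b (n ∸ p)) (λ i → c₀ ^ i * a i (p ∸ i))) ⟩
      Σ≤ n (λ p → Σ≤ p (λ i → (c₀ ^ i * a i (p ∸ i)) * diagonal c₀ b (n ∸ p)))
        ≡⟨ Σ≤-reassoc n (λ i j r → (c₀ ^ i * a i j) * diagonal c₀ b r) ⟩
      Σ≤ n (λ i → Σ≤ (n ∸ i) (λ j → (c₀ ^ i * a i j) * diagonal c₀ b (n ∸ i ∸ j)))
        ≡⟨ Σ<-cong (suc n) (λ i _ → Σ<-cong (suc (n ∸ i)) (λ j _ → distribute i j (n ∸ i ∸ j))) ⟩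
      diagonal₂ n ∎
      where
      open ≡-Reasoning
      distribute : ∀ i j r → (c₀ ^ i * a i j) * diagonal c₀ b r ≡ Σ≤ r (λ l → T i l j (r ∸ l))
      distribute i j r = trans (Σ<-*ˡ (suc r) (c₀ ^ i * a i j) (λ l → c₀ ^ l * b l (r ∸ l)))
        (Σ<-cong (suc r) (λ l _ → *-interchange (c₀ ^ i) (a i j) (c₀ ^ l) (b l (r ∸ l))))

  diagonal-⋆₂ : ∀ c₀ (a b : ℕ → ℕ → A) n →
    diagonal c₀ (a ⋆₂ b) n ≡ (diagonal c₀ a ⋆ diagonal c₀ b) n
  diagonal-⋆₂ c₀ a b n = trans (diagonal-⋆₂≡diagonal₂ c₀ a b n) (sym (⋆-diagonal≡diagonal₂ c₀ a b n))

  monomial : ∀ {k} → Vec A k → Vec ℕ k → A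
  monomial []       []      = 1#
  monomial (c ∷ cs) (x ∷ m) = c ^ x * monomial cs m

  coeffAt : ∀ {k} → Vec A k → Series k → ℕ → A
  coeffAt {k} c F n = sum (map (λ m → monomial c m * ι (F m)) (comps k n))

  slice : ∀ {k} → Series (suc k) → ℕ → Series k
  slice F x m = F (x ∷ m)

  ι-sumℚ : ∀ (g : B → ℚ.ℚ) xs → ι (sumℚ (map g xs)) ≡ sum (map (ι ∘ g) xs)
  ι-sumℚ g []       = ι-0
  ι-sumℚ g (x ∷ xs) = trans (ι-+ (g x) _) (cong (ι (g x) +_) (ι-sumℚ g xs))

  module _ {k} (c : Vec A k) where

    coeffAt-cong : ∀ {F G : Series k} → (∀ m → F m ≡ G m) → ∀ n → coeffAt c F n ≡ coeffAt c G n
    coeffAt-cong F≗G n = sum-map-cong (λ m → cong (λ q → monomial c m * ι q) (F≗G m)) (comps k n)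

    coeffAt-+ : ∀ (F G : Series k) n → coeffAt c (λ m → F m ℚ.+ G m) n ≡ coeffAt c F n + coeffAt c G n
    coeffAt-+ F G n = trans
      (sum-map-cong (λ m → trans (cong (monomial c m *_) (ι-+ (F m) (G m))) (distribˡ _ _ _)) (comps k n))
      (sum-map-+ (λ m → monomial c m * ι (F m)) (λ m → monomial c m * ι (G m)) (comps k n))

    coeffAt-zero : ∀ n → coeffAt c (λ _ → ℚ.0ℚ) n ≡ 0#
    coeffAt-zero n = trans (sum-map-cong (λ m → trans (cong (monomial c m *_) ι-0) (zeroʳ _)) (comps k n))
                           (sum-map-0# (comps k n))

    coeffAt-sum : ∀ {F : Series k} (H : B → Series k) xs → (∀ m → ι (F m) ≡ sum (map (λ i → ι (H i m)) xs)) →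
                  ∀ n → coeffAt c F n ≡ sum (map (λ i → coeffAt c (H i) n) xs)
    coeffAt-sum {F = F} H xs F≡ΣH n = begin
      sum (map (λ m → monomial c m * ι (F m)) (comps k n))
        ≡⟨ sum-map-cong (λ m → trans (cong (monomial c m *_) (F≡ΣH m)) (sum-map-*ˡ (monomial c m) _ xs))
                        (comps k n) ⟩
      sum (map (λ m → sum (map (λ i → monomial c m * ι (H i m)) xs)) (comps k n))
        ≡⟨ sum-map-swap (λ m i → monomial c m * ι (H i m)) (comps k n) xs ⟩
      sum (map (λ i → coeffAt c (H i) n) xs) ∎
      where open ≡-Reasoning

  coeffAt-∷ : ∀ {k} c₀ (c : Vec A k) (F : Series (suc k)) n →
    coeffAt (c₀ ∷ c) F n ≡ diagonal c₀ (coeffAt c ∘ slice F) n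
  coeffAt-∷ {k} c₀ c F n = begin
    coeffAt (c₀ ∷ c) F n
      ≡⟨ sum-concatMap term (λ x → map (x ∷_) (comps k (n ∸ x))) (upTo (suc n)) ⟩
    sum (map (λ x → sum (map term (map (x ∷_) (comps k (n ∸ x))))) (upTo (suc n)))
      ≡⟨ sum-map-cong factor-power (upTo (suc n)) ⟩
    sum (map (λ x → c₀ ^ x * coeffAt c (slice F x) (n ∸ x)) (upTo (suc n)))
      ≡⟨ sum-map-upTo _ (suc n) ⟩
    diagonal c₀ (coeffAt c ∘ slice F) n ∎
    where
    open ≡-Reasoning
    term : Vec ℕ (suc k) → A
    term m = monomial (c₀ ∷ c) m * ι (F m)
    factor-power : ∀ x → sum (map term (map (x ∷_) (comps k (n ∸ x)))) ≡ c₀ ^ x * coeffAt c (slice F x) (n ∸ x)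
    factor-power x = trans (cong sum (sym (map-∘ ms)))
      (trans (sum-map-cong (λ m → *-assoc _ _ _) ms) (sym (sum-map-*ˡ (c₀ ^ x) _ ms)))
      where ms = comps k (n ∸ x)

  ι-⊛-∷ : ∀ {k} (F G : Series (suc k)) x m →
    ι ((F ⊛ G) (x ∷ m)) ≡ sum (map (λ i → ι ((slice F i ⊛ slice G (x ∸ i)) m)) (upTo (suc x)))
  ι-⊛-∷ {k} F G x m = begin
    ι ((F ⊛ G) (x ∷ m))
      ≡⟨ ι-sumℚ _ (below (x ∷ m)) ⟩
    sum (map term (concatMap (λ i → map (i ∷_) (below m)) (upTo (suc x))))
      ≡⟨ sum-concatMap term (λ i → map (i ∷_) (below m)) (upTo (suc x)) ⟩
    sum (map (λ i → sum (map term (map (i ∷_) (below m)))) (upTo (suc x)))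
      ≡⟨ sum-map-cong (λ i → trans (cong sum (sym (map-∘ (below m)))) (sym (ι-sumℚ _ (below m))))
                      (upTo (suc x)) ⟩
    sum (map (λ i → ι ((slice F i ⊛ slice G (x ∸ i)) m)) (upTo (suc x))) ∎
    where
    open ≡-Reasoning
    term : Vec ℕ (suc k) → A
    term d = ι (F d ℚ.* G (Vec.zipWith _∸_ (x ∷ m) d))

  coeffAt-[]-0 : ∀ (F : Series 0) → coeffAt [] F 0 ≡ ι (F [])
  coeffAt-[]-0 F = trans (+-identityʳ _) (*-identityˡ _)

  coeffAt-⊛ : ∀ {k} (c : Vec A k) (F G : Series k) n → coeffAt c (F ⊛ G) n ≡ (coeffAt c F ⋆ coeffAt c G) n
  coeffAt-⊛ [] F G zero = begin
    coeffAt [] (F ⊛ G) 0             ≡⟨ coeffAt-[]-0 (F ⊛ G) ⟩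
    ι (F [] ℚ.* G [] ℚ.+ ℚ.0ℚ)       ≡⟨ cong ι (ℚP.+-identityʳ _) ⟩
    ι (F [] ℚ.* G [])                ≡⟨ ι-* (F []) (G []) ⟩
    ι (F []) * ι (G [])              ≡⟨ sym (cong₂ _*_ (coeffAt-[]-0 F) (coeffAt-[]-0 G)) ⟩
    coeffAt [] F 0 * coeffAt [] G 0  ≡⟨ sym (+-identityʳ _) ⟩
    (coeffAt [] F ⋆ coeffAt [] G) 0  ∎
    where open ≡-Reasoning
  coeffAt-⊛ [] F G (suc n) = sym (trans
    (cong₂ _+_ (zeroʳ _) (Σ<-zero (suc n) (λ i _ → zeroˡ (coeffAt [] G (n ∸ i)))))
    (+-identityˡ 0#))
  coeffAt-⊛ (c₀ ∷ c) F G n = begin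
    coeffAt (c₀ ∷ c) (F ⊛ G) n
      ≡⟨ coeffAt-∷ c₀ c (F ⊛ G) n ⟩
    diagonal c₀ (coeffAt c ∘ slice (F ⊛ G)) n
      ≡⟨ diagonal-cong c₀ slice-⊛ n ⟩
    diagonal c₀ ((coeffAt c ∘ slice F) ⋆₂ (coeffAt c ∘ slice G)) n
      ≡⟨ diagonal-⋆₂ c₀ (coeffAt c ∘ slice F) (coeffAt c ∘ slice G) n ⟩
    (diagonal c₀ (coeffAt c ∘ slice F) ⋆ diagonal c₀ (coeffAt c ∘ slice G)) n
      ≡⟨ sym (⋆-cong (coeffAt-∷ c₀ c F) (coeffAt-∷ c₀ c G) n) ⟩
    (coeffAt (c₀ ∷ c) F ⋆ coeffAt (c₀ ∷ c) G) n ∎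
    where
    open ≡-Reasoning
    slice-⊛ : ∀ x j → coeffAt c (slice (F ⊛ G) x) j ≡ ((coeffAt c ∘ slice F) ⋆₂ (coeffAt c ∘ slice G)) x j
    slice-⊛ x j = begin
      coeffAt c (slice (F ⊛ G) x) j
        ≡⟨ coeffAt-sum c (λ i → slice F i ⊛ slice G (x ∸ i)) (upTo (suc x)) (ι-⊛-∷ F G x) j ⟩
      sum (map (λ i → coeffAt c (slice F i ⊛ slice G (x ∸ i)) j) (upTo (suc x)))
        ≡⟨ sum-map-upTo _ (suc x) ⟩
      Σ≤ x (λ i → coeffAt c (slice F i ⊛ slice G (x ∸ i)) j)
        ≡⟨ Σ<-cong (suc x) (λ i _ → coeffAt-⊛ c (slice F i) (slice G (x ∸ i)) j) ⟩
      ((coeffAt c ∘ slice F) ⋆₂ (coeffAt c ∘ slice G)) x j ∎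

  oneSeq : ℕ → A
  oneSeq zero    = 1#
  oneSeq (suc _) = 0#

  linearSeq : A → ℕ → A
  linearSeq e zero          = 0#
  linearSeq e (suc zero)    = e
  linearSeq e (suc (suc _)) = 0#

  infixl 8 _⋆^_

  _⋆^_ : (ℕ → A) → ℕ → ℕ → A
  P ⋆^ zero  = oneSeq
  P ⋆^ suc j = P ⋆ (P ⋆^ j)

  linearSeq-⋆-zero : ∀ e X → (linearSeq e ⋆ X) 0 ≡ 0#
  linearSeq-⋆-zero e X = trans (+-identityʳ _) (zeroˡ _)

  linearSeq-⋆-suc : ∀ e X n → (linearSeq e ⋆ X) (suc n) ≡ e * X n
  linearSeq-⋆-suc e X n = begin
    0# * X (suc n) + (e * X n + Σ< n (λ j → 0# * X (n ∸ suc j)))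
      ≡⟨ cong₂ _+_ (zeroˡ _) (cong (e * X n +_) (Σ<-zero n (λ j _ → zeroˡ (X (n ∸ suc j))))) ⟩
    0# + (e * X n + 0#)
      ≡⟨ trans (+-identityˡ _) (+-identityʳ _) ⟩
    e * X n ∎
    where open ≡-Reasoning

  sum-map-linearSeq : ∀ (f : B → A) xs n →
    sum (map (λ x → linearSeq (f x) n) xs) ≡ linearSeq (sum (map f xs)) n
  sum-map-linearSeq f xs zero          = sum-map-0# xs
  sum-map-linearSeq f xs (suc zero)    = refl
  sum-map-linearSeq f xs (suc (suc n)) = sum-map-0# xs

  diagonal-slice₀ : ∀ c₀ (a : ℕ → ℕ → A) → (∀ x j → a (suc x) j ≡ 0#) → ∀ n → diagonal c₀ a n ≡ a 0 n
  diagonal-slice₀ c₀ a tail≡0 n = trans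
    (cong₂ _+_ (*-identityˡ _) (Σ<-zero n (λ x _ → trans (cong (c₀ ^ suc x *_) (tail≡0 x _)) (zeroʳ _))))
    (+-identityʳ _)

  coeffAt-oneS : ∀ {k} (c : Vec A k) n → coeffAt c oneS n ≡ oneSeq n
  coeffAt-oneS []       zero    = trans (coeffAt-[]-0 oneS) ι-1
  coeffAt-oneS []       (suc n) = refl
  coeffAt-oneS (c₀ ∷ c) n       = begin
    coeffAt (c₀ ∷ c) oneS n
      ≡⟨ coeffAt-∷ c₀ c oneS n ⟩
    diagonal c₀ (coeffAt c ∘ slice oneS) n
      ≡⟨ diagonal-slice₀ c₀ (coeffAt c ∘ slice oneS) (λ _ → coeffAt-zero c) n ⟩
    coeffAt c oneS n
      ≡⟨ coeffAt-oneS c n ⟩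
    oneSeq n ∎
    where open ≡-Reasoning

  coeffAt-var : ∀ {k} (c : Vec A k) i n → coeffAt c (var i) n ≡ linearSeq (lookup c i) n
  coeffAt-var (c₀ ∷ c) (Fin.suc i) n = begin
    coeffAt (c₀ ∷ c) (var (Fin.suc i)) n
      ≡⟨ coeffAt-∷ c₀ c (var (Fin.suc i)) n ⟩
    diagonal c₀ (coeffAt c ∘ slice (var (Fin.suc i))) n
      ≡⟨ diagonal-slice₀ c₀ (coeffAt c ∘ slice (var (Fin.suc i))) (λ _ → coeffAt-zero c) n ⟩
    coeffAt c (var i) n
      ≡⟨ coeffAt-var c i n ⟩
    linearSeq (lookup c i) n ∎
    where open ≡-Reasoning
  coeffAt-var (c₀ ∷ c) Fin.zero n = trans (coeffAt-∷ c₀ c (var Fin.zero) n) (diagonal-var₀ n)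
    where
    open ≡-Reasoning
    a : ℕ → ℕ → A
    a = coeffAt c ∘ slice (var Fin.zero)
    diagonal-var₀ : ∀ n → diagonal c₀ a n ≡ linearSeq c₀ n
    diagonal-var₀ zero          = trans (+-identityʳ _) (trans (*-identityˡ _) (coeffAt-zero c 0))
    diagonal-var₀ (suc zero)    = begin
      1# * a 0 1 + (c₀ * 1# * a 1 0 + 0#)
        ≡⟨ cong₂ _+_ (trans (*-identityˡ _) (coeffAt-zero c 1)) (+-identityʳ _) ⟩
      0# + c₀ * 1# * coeffAt c oneS 0
        ≡⟨ trans (+-identityˡ _) (cong (c₀ * 1# *_) (coeffAt-oneS c 0)) ⟩
      c₀ * 1# * 1#
        ≡⟨ trans (*-identityʳ _) (*-identityʳ _) ⟩
      c₀ ∎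
    diagonal-var₀ (suc (suc n)) = begin
      1# * a 0 (2 ℕ.+ n) + (c₀ * 1# * a 1 (suc n) + Σ< (suc n) (λ x → c₀ ^ (2 ℕ.+ x) * a (2 ℕ.+ x) (n ∸ x)))
        ≡⟨ cong₂ _+_ (trans (*-identityˡ _) (coeffAt-zero c _))
                     (cong₂ _+_ (trans (cong (c₀ * 1# *_) (coeffAt-oneS c (suc n))) (zeroʳ _))
                                (Σ<-zero (suc n) (λ x _ →
                                   trans (cong (c₀ ^ (2 ℕ.+ x) *_) (coeffAt-zero c (n ∸ x))) (zeroʳ _)))) ⟩
      0# + (0# + 0#)
        ≡⟨ trans (+-identityˡ _) (+-identityˡ _) ⟩
      0# ∎

  coeffAt-pow : ∀ {k} (c : Vec A k) S j n → coeffAt c (pow S j) n ≡ (coeffAt c S ⋆^ j) n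
  coeffAt-pow c S zero    n = coeffAt-oneS c n
  coeffAt-pow c S (suc j) n =
    trans (coeffAt-⊛ c S (pow S j) n) (⋆-cong {F = coeffAt c S} (λ _ → refl) (coeffAt-pow c S j) n)

  Σᶠ : ∀ {k} → (Fin k → A) → A
  Σᶠ {k} f = sum (map f (allFin k))

  Σᶠ-suc : ∀ {k} (f : Fin (suc k) → A) → Σᶠ f ≡ f Fin.zero + Σᶠ (f ∘ Fin.suc)
  Σᶠ-suc f = cong (λ xs → f Fin.zero + sum xs)
                  (trans (map-tabulate Fin.suc f) (sym (map-tabulate id (f ∘ Fin.suc))))

  module _ {K} (c : Vec A K) where

    coeffAt-linSum : ∀ n → coeffAt c linSum n ≡ linearSeq (Σᶠ (lookup c)) n
    coeffAt-linSum n = begin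
      coeffAt c linSum n
        ≡⟨ coeffAt-sum c var (allFin K) (λ m → ι-sumℚ (λ i → var i m) (allFin K)) n ⟩
      sum (map (λ i → coeffAt c (var i) n) (allFin K))
        ≡⟨ sum-map-cong (λ i → coeffAt-var c i n) (allFin K) ⟩
      sum (map (λ i → linearSeq (lookup c i) n) (allFin K))
        ≡⟨ sum-map-linearSeq (lookup c) (allFin K) n ⟩
      linearSeq (Σᶠ (lookup c)) n ∎
      where open ≡-Reasoning

    coeffAt-sumTerm : ∀ S j →
      coeffAt c (sumTerm S) (suc j) ≡ Σᶠ (λ i → lookup c i * (coeffAt c S ⋆^ (2 ℕ.+ toℕ i)) j)
    coeffAt-sumTerm S j = begin
      coeffAt c (sumTerm S) (suc j)
        ≡⟨ coeffAt-sum c term (allFin K) (λ m → ι-sumℚ (λ i → term i m) (allFin K)) (suc j) ⟩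
      sum (map (λ i → coeffAt c (term i) (suc j)) (allFin K))
        ≡⟨ sum-map-cong evaluate-term (allFin K) ⟩
      Σᶠ (λ i → lookup c i * (coeffAt c S ⋆^ (2 ℕ.+ toℕ i)) j) ∎
      where
      open ≡-Reasoning
      term : Fin K → Series K
      term i = var i ⊛ pow S (2 ℕ.+ toℕ i)
      evaluate-term : ∀ i → coeffAt c (term i) (suc j) ≡ lookup c i * (coeffAt c S ⋆^ (2 ℕ.+ toℕ i)) j
      evaluate-term i = trans (coeffAt-⊛ c (var i) (pow S (2 ℕ.+ toℕ i)) (suc j))
        (trans (⋆-cong (coeffAt-var c i) (coeffAt-pow c S (2 ℕ.+ toℕ i)) (suc j))
               (linearSeq-⋆-suc (lookup c i) (coeffAt c S ⋆^ (2 ℕ.+ toℕ i)) j))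

    coeffAt-geode : ∀ {S G} → (∀ m → S m ≡ oneS m ℚ.+ (linSum ⊛ G) m) →
      ∀ n → coeffAt c S n ≡ oneSeq n + (linearSeq (Σᶠ (lookup c)) ⋆ coeffAt c G) n
    coeffAt-geode {S} {G} S≡1+LG n = begin
      coeffAt c S n
        ≡⟨ coeffAt-cong c S≡1+LG n ⟩
      coeffAt c (λ m → oneS m ℚ.+ (linSum ⊛ G) m) n
        ≡⟨ coeffAt-+ c oneS (linSum ⊛ G) n ⟩
      coeffAt c oneS n + coeffAt c (linSum ⊛ G) n
        ≡⟨ cong₂ _+_ (coeffAt-oneS c n)
                     (trans (coeffAt-⊛ c linSum G n)
                            (⋆-cong {G = coeffAt c G} coeffAt-linSum (λ _ → refl) n)) ⟩
      oneSeq n + (linearSeq (Σᶠ (lookup c)) ⋆ coeffAt c G) n ∎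
      where open ≡-Reasoning

    coeffAt-functional-equation : ∀ {S} → (∀ m → S m ≡ oneS m ℚ.+ sumTerm S m) →
      ∀ j → coeffAt c S (suc j) ≡ Σᶠ (λ i → lookup c i * (coeffAt c S ⋆^ (2 ℕ.+ toℕ i)) j)
    coeffAt-functional-equation {S} S≡1+ΣtS j = begin
      coeffAt c S (suc j)
        ≡⟨ coeffAt-cong c S≡1+ΣtS (suc j) ⟩
      coeffAt c (λ m → oneS m ℚ.+ sumTerm S m) (suc j)
        ≡⟨ coeffAt-+ c oneS (sumTerm S) (suc j) ⟩
      coeffAt c oneS (suc j) + coeffAt c (sumTerm S) (suc j)
        ≡⟨ cong₂ _+_ (coeffAt-oneS c (suc j)) (coeffAt-sumTerm S j) ⟩
      0# + Σᶠ (λ i → lookup c i * (coeffAt c S ⋆^ (2 ℕ.+ toℕ i)) j)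
        ≡⟨ +-identityˡ _ ⟩
      Σᶠ (λ i → lookup c i * (coeffAt c S ⋆^ (2 ℕ.+ toℕ i)) j) ∎
      where open ≡-Reasoning

  module _ {P : ℕ → A} (P₀≡1 : P 0 ≡ 1#) where

    ⋆^-zero : ∀ j → (P ⋆^ j) 0 ≡ 1#
    ⋆^-zero zero    = refl
    ⋆^-zero (suc j) = trans (+-identityʳ _) (trans (cong₂ _*_ P₀≡1 (⋆^-zero j)) (*-identityˡ 1#))

    module _ {ε : A} {q : ℕ → A} (ε*ε≡0 : ε * ε ≡ 0#) (P-suc : ∀ n → P (suc n) ≡ ε * q n) where

      ⋆^-suc : ∀ j n → (P ⋆^ j) (suc n) ≡ ε * (j × q n)
      ⋆^-suc zero    n = sym (zeroʳ ε)
      ⋆^-suc (suc j) n = begin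
        P 0 * R (suc n) + Σ< (suc n) H
          ≡⟨ cong₂ _+_ (cong₂ _*_ P₀≡1 (⋆^-suc j n)) (Σ<-last n H) ⟩
        1# * (ε * (j × q n)) + (Σ< n H + H n)
          ≡⟨ cong₂ _+_ (*-identityˡ _) (cong₂ _+_ (Σ<-zero n H-vanishes) last-term) ⟩
        ε * (j × q n) + (0# + ε * q n)
          ≡⟨ trans (cong (ε * (j × q n) +_) (+-identityˡ _)) (+-comm _ _) ⟩
        ε * q n + ε * (j × q n)
          ≡⟨ sym (distribˡ ε _ _) ⟩
        ε * (suc j × q n) ∎
        where
        open ≡-Reasoning
        R : ℕ → A
        R = P ⋆^ j
        H : ℕ → A
        H t = P (suc t) * R (n ∸ t)
        ∸-suc : ∀ {t n} → t < n → n ∸ t ≡ suc (n ∸ suc t)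
        ∸-suc {t} {suc n} (s≤s t≤n) = ℕP.+-∸-assoc 1 t≤n
        H-vanishes : ∀ t → t < n → H t ≡ 0#
        H-vanishes t t<n = begin
          P (suc t) * R (n ∸ t)                ≡⟨ cong₂ _*_ (P-suc t) (cong R (∸-suc t<n)) ⟩
          ε * q t * R (suc (n ∸ suc t))        ≡⟨ cong (ε * q t *_) (⋆^-suc j (n ∸ suc t)) ⟩
          ε * q t * (ε * (j × q (n ∸ suc t)))  ≡⟨ *-interchange _ _ _ _ ⟩
          ε * ε * (q t * (j × q (n ∸ suc t)))  ≡⟨ cong (_* (q t * (j × q (n ∸ suc t)))) ε*ε≡0 ⟩
          0# * (q t * (j × q (n ∸ suc t)))     ≡⟨ zeroˡ _ ⟩
          0#                                   ∎
        last-term : H n ≡ ε * q n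
        last-term = trans (cong₂ _*_ (P-suc n) (trans (cong R (ℕP.n∸n≡0 n)) (⋆^-zero j))) (*-identityʳ _)

  alternating : Bool → (k : ℕ) → Vec A k
  alternating _     zero    = []
  alternating true  (suc k) = - 1# ∷ alternating false k
  alternating false (suc k) = 1# ∷ alternating true k

  perturbHead : ∀ {k} → A → Vec A (suc k) → Vec A (suc k)
  perturbHead e (x ∷ xs) = x + e ∷ xs

  Σᶠ-perturbHead : ∀ {k} e (v : Vec A (suc k)) (h : ℕ → A) →
    Σᶠ (λ i → lookup (perturbHead e v) i * h (toℕ i)) ≡ e * h 0 + Σᶠ (λ i → lookup v i * h (toℕ i))
  Σᶠ-perturbHead e (x ∷ xs) h = begin
    Σᶠ (λ i → lookup (x + e ∷ xs) i * h (toℕ i))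
      ≡⟨ Σᶠ-suc (λ i → lookup (x + e ∷ xs) i * h (toℕ i)) ⟩
    (x + e) * h 0 + rest
      ≡⟨ cong (_+ rest) (distribʳ (h 0) x e) ⟩
    (x * h 0 + e * h 0) + rest
      ≡⟨ xy∙z≈y∙xz (x * h 0) (e * h 0) rest ⟩
    e * h 0 + (x * h 0 + rest)
      ≡⟨ cong (e * h 0 +_) (sym (Σᶠ-suc (λ i → lookup (x ∷ xs) i * h (toℕ i)))) ⟩
    e * h 0 + Σᶠ (λ i → lookup (x ∷ xs) i * h (toℕ i)) ∎
    where
    open ≡-Reasoning
    rest : A
    rest = Σᶠ (λ i → lookup xs i * h (suc (toℕ i)))

  -- The length is an equation rather than 2 * a itself because 2 * suc a does not reduce to
  -- suc (suc (2 * a)).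
  Σᶠ-alternating : ∀ a {K} → K ≡ 2 ℕ.* a → (h : ℕ → A) (d : A) → (∀ i → h (suc i) ≡ d + h i) →
    Σᶠ (λ i → lookup (alternating true K) i * h (toℕ i)) ≡ a × d
  Σᶠ-alternating zero    refl h d step = refl
  Σᶠ-alternating (suc a) K≡2+2a h d step with trans K≡2+2a (ℕP.*-suc 2 a)
  ... | refl = begin
    Σᶠ (λ i → lookup (alternating true (2 ℕ.+ 2 ℕ.* a)) i * h (toℕ i))
      ≡⟨ Σᶠ-suc (λ i → lookup (alternating true (2 ℕ.+ 2 ℕ.* a)) i * h (toℕ i)) ⟩
    - 1# * h 0 + Σᶠ (λ i → lookup (alternating false (1 ℕ.+ 2 ℕ.* a)) i * h (suc (toℕ i)))
      ≡⟨ cong (- 1# * h 0 +_) (Σᶠ-suc (λ i → lookup (alternating false (1 ℕ.+ 2 ℕ.* a)) i * h (suc (toℕ i)))) ⟩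
    - 1# * h 0 + (1# * h 1 + rest)
      ≡⟨ cong (λ t → - 1# * h 0 + (1# * t + rest)) (step 0) ⟩
    - 1# * h 0 + (1# * (d + h 0) + rest)
      ≡⟨ cancel-pair (h 0) ⟩
    d + rest
      ≡⟨ cong (d +_) (Σᶠ-alternating a refl (h ∘ suc ∘ suc) d (step ∘ suc ∘ suc)) ⟩
    d + a × d ∎
    where
    open ≡-Reasoning
    rest : A
    rest = Σᶠ (λ i → lookup (alternating true (2 ℕ.* a)) i * h (suc (suc (toℕ i))))
    cancel-pair : ∀ x → - 1# * x + (1# * (d + x) + rest) ≡ d + rest
    cancel-pair x = begin
      - 1# * x + (1# * (d + x) + rest)  ≡⟨ cong₂ _+_ (-1*x≈-x x) (cong (_+ rest) (*-identityˡ _)) ⟩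
      - x + ((d + x) + rest)            ≡⟨ cong (- x +_) (xy∙z≈y∙xz d x rest) ⟩
      - x + (x + (d + rest))            ≡⟨ sym (+-assoc _ _ _) ⟩
      (- x + x) + (d + rest)            ≡⟨ cong (_+ (d + rest)) (-‿inverseˡ x) ⟩
      0# + (d + rest)                   ≡⟨ +-identityˡ _ ⟩
      d + rest                          ∎

  module Geode (ε : A) (ε*ε≡0 : ε * ε ≡ 0#) (a : ℕ) {S G : Series (2 ℕ.* suc a)}
    (S≡1+LG : ∀ m → S m ≡ oneS m ℚ.+ (linSum ⊛ G) m)
    (S≡1+ΣtS : ∀ m → S m ≡ oneS m ℚ.+ sumTerm S m)
    where

    c : Vec A (2 ℕ.* suc a)
    c = perturbHead ε (alternating true (2 ℕ.* suc a))

    P Q : ℕ → A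
    P = coeffAt c S
    Q = coeffAt c G

    Σᶠ-c*-progression : ∀ (h : ℕ → A) d → (∀ i → h (suc i) ≡ d + h i) →
      Σᶠ (λ i → lookup c i * h (toℕ i)) ≡ ε * h 0 + suc a × d
    Σᶠ-c*-progression h d step = trans (Σᶠ-perturbHead ε (alternating true (2 ℕ.* suc a)) h)
                                       (cong (ε * h 0 +_) (Σᶠ-alternating (suc a) refl h d step))

    Σᶠ-c*1 : Σᶠ (λ i → lookup c i * 1#) ≡ ε
    Σᶠ-c*1 = begin
      Σᶠ (λ i → lookup c i * 1#)  ≡⟨ Σᶠ-c*-progression (λ _ → 1#) 0# (λ _ → sym (+-identityˡ 1#)) ⟩
      ε * 1# + suc a × 0#         ≡⟨ cong₂ _+_ (*-identityʳ ε) (×-zeroʳ (suc a)) ⟩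
      ε + 0#                      ≡⟨ +-identityʳ ε ⟩
      ε                           ∎
      where
      open ≡-Reasoning
      ×-zeroʳ : ∀ n → n × 0# ≡ 0#
      ×-zeroʳ zero    = refl
      ×-zeroʳ (suc n) = trans (+-identityˡ _) (×-zeroʳ n)

    Σᶠ-c : Σᶠ (lookup c) ≡ ε
    Σᶠ-c = trans (sum-map-cong (λ i → sym (*-identityʳ (lookup c i))) (allFin _)) Σᶠ-c*1

    P-zero : P 0 ≡ 1#
    P-zero = begin
      P 0                                       ≡⟨ coeffAt-geode c S≡1+LG 0 ⟩
      1# + (linearSeq (Σᶠ (lookup c)) ⋆ Q) 0    ≡⟨ cong (1# +_) (linearSeq-⋆-zero (Σᶠ (lookup c)) Q) ⟩
      1# + 0#                                   ≡⟨ +-identityʳ 1# ⟩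
      1#                                        ∎
      where open ≡-Reasoning

    P-suc : ∀ n → P (suc n) ≡ ε * Q n
    P-suc n = begin
      P (suc n)                                     ≡⟨ coeffAt-geode c S≡1+LG (suc n) ⟩
      0# + (linearSeq (Σᶠ (lookup c)) ⋆ Q) (suc n)  ≡⟨ +-identityˡ _ ⟩
      (linearSeq (Σᶠ (lookup c)) ⋆ Q) (suc n)       ≡⟨ linearSeq-⋆-suc (Σᶠ (lookup c)) Q n ⟩
      Σᶠ (lookup c) * Q n                           ≡⟨ cong (_* Q n) Σᶠ-c ⟩
      ε * Q n                                       ∎
      where open ≡-Reasoning

    Q-zero : ε * Q 0 ≡ ε * 1#
    Q-zero = begin
      ε * Q 0
        ≡⟨ sym (P-suc 0) ⟩
      P 1
        ≡⟨ coeffAt-functional-equation c S≡1+ΣtS 0 ⟩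
      Σᶠ (λ i → lookup c i * (P ⋆^ (2 ℕ.+ toℕ i)) 0)
        ≡⟨ sum-map-cong (λ i → cong (lookup c i *_) (⋆^-zero P-zero (2 ℕ.+ toℕ i))) (allFin _) ⟩
      Σᶠ (λ i → lookup c i * 1#)
        ≡⟨ trans Σᶠ-c*1 (sym (*-identityʳ ε)) ⟩
      ε * 1# ∎
      where open ≡-Reasoning

    Q-suc : ∀ j → ε * Q (suc j) ≡ ε * (suc a × Q j)
    Q-suc j = begin
      ε * Q (suc j)
        ≡⟨ sym (P-suc (suc j)) ⟩
      P (suc (suc j))
        ≡⟨ coeffAt-functional-equation c S≡1+ΣtS (suc j) ⟩
      Σᶠ (λ i → lookup c i * (P ⋆^ (2 ℕ.+ toℕ i)) (suc j))
        ≡⟨ sum-map-cong (λ i → cong (lookup c i *_) (⋆^-suc P-zero ε*ε≡0 P-suc (2 ℕ.+ toℕ i) j)) (allFin _) ⟩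
      Σᶠ (λ i → lookup c i * h (toℕ i))
        ≡⟨ Σᶠ-c*-progression h (ε * Q j) (λ i → distribˡ ε (Q j) ((2 ℕ.+ i) × Q j)) ⟩
      ε * h 0 + suc a × (ε * Q j)
        ≡⟨ cong₂ _+_ ε*h₀≡0 (sym (×-comm-* (suc a) ε (Q j))) ⟩
      0# + ε * (suc a × Q j)
        ≡⟨ +-identityˡ _ ⟩
      ε * (suc a × Q j) ∎
      where
      open ≡-Reasoning
      h : ℕ → A
      h i = ε * ((2 ℕ.+ i) × Q j)
      ε*h₀≡0 : ε * h 0 ≡ 0#
      ε*h₀≡0 = trans (sym (*-assoc ε ε _)) (trans (cong (_* (2 × Q j)) ε*ε≡0) (zeroˡ _))

ringℚ : AlmostCommutativeRing 0ℓ 0ℓ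
ringℚ = fromCommutativeRing ℚP.+-*-commutativeRing (λ q → dec⇒maybe (ℚ.0ℚ ℚP.≟ q))

-- natℚ n = + n / 1 does not compute for a variable n (it is stuck on gcd n 1).
natℚ≡mkℚ : ∀ n → natℚ n ≡ ℚ.mkℚ (ℤ.+ n) 0 (Coprime.sym (Coprime.1-coprimeTo n))
natℚ≡mkℚ n = ℚP.normalize-coprime (Coprime.sym (Coprime.1-coprimeTo n))

natℚ-+ : ∀ m n → natℚ (m ℕ.+ n) ≡ natℚ m ℚ.+ natℚ n
natℚ-+ m n rewrite natℚ≡mkℚ m | natℚ≡mkℚ n =
  cong (ℚ._/ 1) (sym (cong₂ ℤ._+_ (ℤP.*-identityʳ (ℤ.+ m)) (ℤP.*-identityʳ (ℤ.+ n))))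

natℚ-* : ∀ m n → natℚ (m ℕ.* n) ≡ natℚ m ℚ.* natℚ n
natℚ-* zero    n = sym (ℚP.*-zeroˡ (natℚ n))
natℚ-* (suc m) n = begin
  natℚ (n ℕ.+ m ℕ.* n)                    ≡⟨ trans (natℚ-+ n (m ℕ.* n)) (cong (natℚ n ℚ.+_) (natℚ-* m n)) ⟩
  natℚ n ℚ.+ natℚ m ℚ.* natℚ n            ≡⟨ cong (ℚ._+ natℚ m ℚ.* natℚ n) (sym (ℚP.*-identityˡ (natℚ n))) ⟩
  ℚ.1ℚ ℚ.* natℚ n ℚ.+ natℚ m ℚ.* natℚ n   ≡⟨ sym (ℚP.*-distribʳ-+ (natℚ n) ℚ.1ℚ (natℚ m)) ⟩
  (ℚ.1ℚ ℚ.+ natℚ m) ℚ.* natℚ n            ≡⟨ cong (ℚ._* natℚ n) (sym (natℚ-+ 1 m)) ⟩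
  natℚ (suc m) ℚ.* natℚ n                 ∎
  where open ≡-Reasoning

natℚ-geometric : ∀ a {x : ℕ → ℚ.ℚ} → x 0 ≡ ℚ.1ℚ → (∀ j → x (suc j) ≡ natℚ a ℚ.* x j) →
                 ∀ n → x n ≡ natℚ (a ℕ.^ n)
natℚ-geometric a x₀≡1 x-suc zero    = x₀≡1
natℚ-geometric a x₀≡1 x-suc (suc n) = trans (x-suc n)
  (trans (cong (natℚ a ℚ.*_) (natℚ-geometric a x₀≡1 x-suc n)) (sym (natℚ-* a (a ℕ.^ n))))

p-q≡r⇒p≡q+r : ∀ {p q r} → p ℚ.- q ≡ r → p ≡ q ℚ.+ r
p-q≡r⇒p≡q+r {p} {q} p-q≡r = trans (regroup p q) (cong (q ℚ.+_) p-q≡r)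
  where
  regroup : ∀ p q → p ≡ q ℚ.+ (p ℚ.- q)
  regroup = solve-∀ ringℚ

q-p+r≡0⇒p≡q+r : ∀ {p q r} → (q ℚ.- p) ℚ.+ r ≡ ℚ.0ℚ → p ≡ q ℚ.+ r
q-p+r≡0⇒p≡q+r {p} {q} {r} q-p+r≡0 =
  trans (sym (ℚP.+-identityʳ p)) (trans (cong (p ℚ.+_) (sym q-p+r≡0)) (regroup p q r))
  where
  regroup : ∀ p q r → p ℚ.+ ((q ℚ.- p) ℚ.+ r) ≡ q ℚ.+ r
  regroup = solve-∀ ringℚ

infix 5 _+ε_

record Dual : Set where
  constructor _+ε_
  field
    re ep : ℚ.ℚ

open Dual

infixl 6 _+ᴰ_
infixl 7 _*ᴰ_
infix 8 -ᴰ_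

_+ᴰ_ : Dual → Dual → Dual
x +ᴰ y = re x ℚ.+ re y +ε ep x ℚ.+ ep y

_*ᴰ_ : Dual → Dual → Dual
x *ᴰ y = re x ℚ.* re y +ε re x ℚ.* ep y ℚ.+ ep x ℚ.* re y

-ᴰ_ : Dual → Dual
-ᴰ x = ℚ.- re x +ε ℚ.- ep x

0ᴰ 1ᴰ ε : Dual
0ᴰ = ℚ.0ℚ +ε ℚ.0ℚ
1ᴰ = ℚ.1ℚ +ε ℚ.0ℚ
ε  = ℚ.0ℚ +ε ℚ.1ℚ

Dual-isCommutativeRing : IsCommutativeRing _≡_ _+ᴰ_ _*ᴰ_ -ᴰ_ 0ᴰ 1ᴰ
Dual-isCommutativeRing = record
  { isRing = record
    { +-isAbelianGroup = record
      { isGroup = record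
        { isMonoid = record
          { isSemigroup = record
            { isMagma = record { isEquivalence = isEquivalence ; ∙-cong = cong₂ _+ᴰ_ }
            ; assoc = λ x y z → cong₂ _+ε_ (ℚP.+-assoc (re x) (re y) (re z)) (ℚP.+-assoc (ep x) (ep y) (ep z))
            }
          ; identity = (λ x → cong₂ _+ε_ (ℚP.+-identityˡ (re x)) (ℚP.+-identityˡ (ep x)))
                     , (λ x → cong₂ _+ε_ (ℚP.+-identityʳ (re x)) (ℚP.+-identityʳ (ep x)))
          }
        ; inverse = (λ x → cong₂ _+ε_ (ℚP.+-inverseˡ (re x)) (ℚP.+-inverseˡ (ep x)))
                  , (λ x → cong₂ _+ε_ (ℚP.+-inverseʳ (re x)) (ℚP.+-inverseʳ (ep x)))
        ; ⁻¹-cong = cong -ᴰ_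
        }
      ; comm = λ x y → cong₂ _+ε_ (ℚP.+-comm (re x) (re y)) (ℚP.+-comm (ep x) (ep y))
      }
    ; *-cong = cong₂ _*ᴰ_
    ; *-assoc = *ᴰ-assoc
    ; *-identity = *ᴰ-identityˡ , *ᴰ-identityʳ
    ; distrib = *ᴰ-distribˡ , *ᴰ-distribʳ
    }
  ; *-comm = *ᴰ-comm
  }
  where
  open ℚ using (_+_; _*_)

  *ᴰ-assoc : ∀ x y z → (x *ᴰ y) *ᴰ z ≡ x *ᴰ (y *ᴰ z)
  *ᴰ-assoc (a +ε a′) (b +ε b′) (c +ε c′) = cong₂ _+ε_ (ℚP.*-assoc a b c) (ep-part a a′ b b′ c c′)
    where
    ep-part : ∀ a a′ b b′ c c′ → (a * b) * c′ + (a * b′ + a′ * b) * c ≡ a * (b * c′ + b′ * c) + a′ * (b * c)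
    ep-part = solve-∀ ringℚ

  *ᴰ-identityˡ : ∀ x → 1ᴰ *ᴰ x ≡ x
  *ᴰ-identityˡ (a +ε a′) = cong₂ _+ε_ (ℚP.*-identityˡ a) (ep-part a a′)
    where
    ep-part : ∀ a a′ → ℚ.1ℚ * a′ + ℚ.0ℚ * a ≡ a′
    ep-part = solve-∀ ringℚ

  *ᴰ-identityʳ : ∀ x → x *ᴰ 1ᴰ ≡ x
  *ᴰ-identityʳ (a +ε a′) = cong₂ _+ε_ (ℚP.*-identityʳ a) (ep-part a a′)
    where
    ep-part : ∀ a a′ → a * ℚ.0ℚ + a′ * ℚ.1ℚ ≡ a′
    ep-part = solve-∀ ringℚ

  *ᴰ-distribˡ : ∀ x y z → x *ᴰ (y +ᴰ z) ≡ x *ᴰ y +ᴰ x *ᴰ z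
  *ᴰ-distribˡ (a +ε a′) (b +ε b′) (c +ε c′) = cong₂ _+ε_ (ℚP.*-distribˡ-+ a b c) (ep-part a a′ b b′ c c′)
    where
    ep-part : ∀ a a′ b b′ c c′ → a * (b′ + c′) + a′ * (b + c) ≡ (a * b′ + a′ * b) + (a * c′ + a′ * c)
    ep-part = solve-∀ ringℚ

  *ᴰ-distribʳ : ∀ x y z → (y +ᴰ z) *ᴰ x ≡ y *ᴰ x +ᴰ z *ᴰ x
  *ᴰ-distribʳ (a +ε a′) (b +ε b′) (c +ε c′) = cong₂ _+ε_ (ℚP.*-distribʳ-+ a b c) (ep-part a a′ b b′ c c′)
    where
    ep-part : ∀ a a′ b b′ c c′ → (b + c) * a′ + (b′ + c′) * a ≡ (b * a′ + b′ * a) + (c * a′ + c′ * a)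
    ep-part = solve-∀ ringℚ

  *ᴰ-comm : ∀ x y → x *ᴰ y ≡ y *ᴰ x
  *ᴰ-comm (a +ε a′) (b +ε b′) = cong₂ _+ε_ (ℚP.*-comm a b) (ep-part a a′ b b′)
    where
    ep-part : ∀ a a′ b b′ → a * b′ + a′ * b ≡ b * a′ + b′ * a
    ep-part = solve-∀ ringℚ

ιᴰ : ℚ.ℚ → Dual
ιᴰ q = q +ε ℚ.0ℚ

ιᴰ-* : ∀ p q → ιᴰ (p ℚ.* q) ≡ ιᴰ p *ᴰ ιᴰ q
ιᴰ-* p q = cong (p ℚ.* q +ε_) (zero-ep p q)
  where
  zero-ep : ∀ p q → ℚ.0ℚ ≡ p ℚ.* ℚ.0ℚ ℚ.+ ℚ.0ℚ ℚ.* q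
  zero-ep = solve-∀ ringℚ

open Substitution Dual-isCommutativeRing ιᴰ refl refl (λ _ _ → refl) ιᴰ-*
  using (module Geode; coeffAt; monomial; alternating; perturbHead; sum) renaming (_×_ to _×ᴰ_; _^_ to _^ᴰ_)

ε*ᴰ-ep : ∀ x → ep (ε *ᴰ x) ≡ re x
ε*ᴰ-ep x = lemma (re x) (ep x)
  where
  lemma : ∀ a a′ → ℚ.0ℚ ℚ.* a′ ℚ.+ ℚ.1ℚ ℚ.* a ≡ a
  lemma = solve-∀ ringℚ

ε*ᴰ-cancel-re : ∀ x y → ε *ᴰ x ≡ ε *ᴰ y → re x ≡ re y
ε*ᴰ-cancel-re x y εx≡εy = trans (sym (ε*ᴰ-ep x)) (trans (cong ep εx≡εy) (ε*ᴰ-ep y))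

re-× : ∀ n x → re (n ×ᴰ x) ≡ natℚ n ℚ.* re x
re-× zero    x = sym (ℚP.*-zeroˡ (re x))
re-× (suc n) x = begin
  re x ℚ.+ re (n ×ᴰ x)                  ≡⟨ cong₂ ℚ._+_ (sym (ℚP.*-identityˡ (re x))) (re-× n x) ⟩
  ℚ.1ℚ ℚ.* re x ℚ.+ natℚ n ℚ.* re x    ≡⟨ sym (ℚP.*-distribʳ-+ (re x) ℚ.1ℚ (natℚ n)) ⟩
  (ℚ.1ℚ ℚ.+ natℚ n) ℚ.* re x           ≡⟨ cong (ℚ._* re x) (sym (natℚ-+ 1 n)) ⟩
  natℚ (suc n) ℚ.* re x                ∎
  where open ≡-Reasoning

re-^-negPow : ∀ {x} → re x ≡ ℚ.- ℚ.1ℚ → ∀ n → re (x ^ᴰ n) ≡ negPow n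
re-^-negPow re-x≡-1 zero    = refl
re-^-negPow re-x≡-1 (suc n) =
  trans (cong₂ ℚ._*_ re-x≡-1 (re-^-negPow re-x≡-1 n))
        (trans (sym (ℚP.neg-distribˡ-* ℚ.1ℚ (negPow n))) (cong ℚ.-_ (ℚP.*-identityˡ (negPow n))))

re-1ᴰ^ : ∀ n → re (1ᴰ ^ᴰ n) ≡ ℚ.1ℚ
re-1ᴰ^ zero    = refl
re-1ᴰ^ (suc n) = trans (ℚP.*-identityˡ _) (re-1ᴰ^ n)

re-monomial-alternating : ∀ b {k} (m : Vec ℕ k) → re (monomial (alternating b k) m) ≡ altSign b m
re-monomial-alternating b     []      = refl
re-monomial-alternating true  (x ∷ m) = cong₂ ℚ._*_ (re-^-negPow refl x) (re-monomial-alternating false m)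
re-monomial-alternating false (x ∷ m) =
  trans (cong₂ ℚ._*_ (re-1ᴰ^ x) (re-monomial-alternating true m)) (ℚP.*-identityˡ _)

re-monomial-perturbHead : ∀ {k} (m : Vec ℕ (suc k)) →
  re (monomial (perturbHead ε (alternating true (suc k))) m) ≡ altSign true m
re-monomial-perturbHead (x ∷ m) =
  cong₂ ℚ._*_ (re-^-negPow (ℚP.+-identityʳ _) x) (re-monomial-alternating false m)

re-sum : ∀ {B : Set} (f : B → Dual) xs → re (sum (map f xs)) ≡ sumℚ (map (re ∘ f) xs)
re-sum f []       = refl
re-sum f (x ∷ xs) = cong (re (f x) ℚ.+_) (re-sum f xs)

re-coeffAt : ∀ {k} (G : Series (suc k)) n →
  re (coeffAt (perturbHead ε (alternating true (suc k))) G n) ≡ substCoeff G n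
re-coeffAt {k} G n = trans (re-sum _ (comps (suc k) n))
  (cong sumℚ (map-cong (λ m → cong (ℚ._* G m) (re-monomial-perturbHead m)) (comps (suc k) n)))

open import Data.Nat using (ℕ; suc; _*_; _^_)
open import Data.Rational using (ℚ; 0ℚ; 1ℚ; _+_; _-_)

theorem3p1 : (a : ℕ) → 1 Data.Nat.≤ a →
    (S G : Series (2 * a)) →
    S (zeroV (2 * a)) ≡ 1ℚ →
    (∀ m → (oneS m - S m) + sumTerm S m ≡ 0ℚ) →
    (∀ m → S m - oneS m ≡ (linSum ⊛ G) m) →
    ∀ n → substCoeff G n ≡ natℚ (a ^ n)
theorem3p1 zero ()
theorem3p1 (suc a) _ S G _ hS hG n = begin
  substCoeff G n      ≡⟨ sym (re-coeffAt G n) ⟩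
  re (Q n)            ≡⟨ natℚ-geometric (suc a) (ε*ᴰ-cancel-re (Q 0) 1ᴰ Q-zero) re-Q-suc n ⟩
  natℚ (suc a ^ n)    ∎
  where
  open ≡-Reasoning
  open Geode ε refl a {S} {G} (λ m → p-q≡r⇒p≡q+r (hG m)) (λ m → q-p+r≡0⇒p≡q+r {q = oneS m} (hS m))
  re-Q-suc : ∀ j → re (Q (suc j)) ≡ natℚ (suc a) ℚ.* re (Q j)
  re-Q-suc j = trans (ε*ᴰ-cancel-re (Q (suc j)) (suc a ×ᴰ Q j) (Q-suc j)) (re-× (suc a) (Q j))
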